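{- Let $G$ be a graph and let $G'$ be the graph constructed from $G$ as described in the context. If $G$ is $3$-colourable, then $G'$ has a $3$-C-E ordering.
   Context: All graphs are finite, simple and undirected. For an ordering $\phi$ of $V(G)$ write $a<_\phi b$ if $a$ precedes $b$; $w$ lies between $a$ and $b$ if $a<_\phi w<_\phi b$ or $b<_\phi w<_\phi a$. An ordering $\phi$ of $V(G)$ is a $3$-C-E ordering of $G$ if whenever $X,Y$ are triangles with $|X\cap Y|=2$, $X\setminus Y=\{a\}$, $Y\setminus X=\{b\}$, and both vertices of $X\cap Y$ lie between $a$ and $b$ in $\phi$, then $ab\in E(G)$. Construction of $G'$: its vertex set is $V(G)$ together with new distinct vertices $A=\{a,a_1,a_2,a_3\}$, $B=\{b,b_1,b_2,b_3\}$, $C=\{c,c_1,c_2,c_3\}$, $D=\{d,d_1,d_2,d_3\}$, $F=\{f^e_i: e\in E(G), 1\le i\le 6\}$ and $T=\{t^e_i: e\in E(G), 1\le i\le 3\}$. Its edges are exactly: all edges of $G$; all edges within each of $A,B,C,D$; for each $e\in E(G)$ and $i\in\{1,2,3\}$, all edges among $t^e_i,f^e_{2i-1},f^e_{2i}$; all edges between $\{a_1,a_2,a_3\}$ and $\{b_1,b_2,b_3\}$, between $\{b_1,b_2,b_3\}$ and $\{c_1,c_2,c_3\}$, between $\{c_1,c_2,c_3\}$ and $\{d_1,d_2,d_3\}$, and between $\{d_1,d_2,d_3\}$ and $\{a_1,a_2,a_3\}$; all edges between $\{a_1,a_2,a_3,b_1,b_2,b_3\}$ and $V(G)$; all edges between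 $\{c_1,c_2,c_3,d_1,d_2,d_3\}$ and $V(G)\cup F$; for each edge $e=uv\in E(G)$ and $1\le i\le 6$, the edges $f^e_iu$ and $f^e_iv$; all edges among the vertices $\{t^e_2,t^e_3: e\in E(G)\}$; and all edges between $\{t^e_1: e\in E(G)\}$ and $\{t^e_2,t^e_3: e\in E(G)\}$. -}

module Defs where

open import Data.Nat using (ℕ; _<_)
open import Data.Fin using (Fin; zero; suc; toℕ)
open import Data.Bool using (Bool; true)
open import Data.Empty using (⊥)
open import Data.Product using (Σ; Σ-syntax; ∃; ∃-syntax; _×_; _,_; proj₁; proj₂)
open import Data.Sum using (_⊎_)
open import Relation.Binary.PropositionalEquality using (_≡_; _≢_)
open import Function.Definitions using (Injective)

record SimpleGraph : Set where
  field
    n      : ℕ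
    adj    : Fin n → Fin n → Bool
    adj-sym    : ∀ u v → adj u v ≡ true → adj v u ≡ true
    adj-irrefl : ∀ u → adj u u ≡ true → ⊥
open SimpleGraph public

Vtx : SimpleGraph → Set
Vtx G = Fin (n G)

Adj : (G : SimpleGraph) → Vtx G → Vtx G → Set
Adj G u v = adj G u v ≡ true

-- The edge set E(G): each edge uv listed once, as (u , v) with u < v.
Edge : SimpleGraph → Set
Edge G = Σ[ u ∈ Vtx G ] Σ[ v ∈ Vtx G ] (toℕ u < toℕ v × Adj G u v)

end₁ : {G : SimpleGraph} → Edge G → Vtx G
end₁ e = proj₁ e

end₂ : {G : SimpleGraph} → Edge G → Vtx G
end₂ e = proj₁ (proj₂ e)

ThreeColourable : SimpleGraph → Set
ThreeColourable G =
  Σ[ c ∈ (Vtx G → Fin 3) ] (∀ u v → Adj G u v → c u ≢ c v)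

-- An ordering of the (finite) vertex set
-- is given by an injective rank function r : V → ℕ, with a <_φ b iff
-- r a < r b.

Ordering : Set → Set
Ordering V = Σ[ r ∈ (V → ℕ) ] Injective _≡_ _≡_ r

module _ {V : Set} where

  Between : Ordering V → V → V → V → Set
  Between φ a w b = (proj₁ φ a < proj₁ φ w × proj₁ φ w < proj₁ φ b)
                  ⊎ (proj₁ φ b < proj₁ φ w × proj₁ φ w < proj₁ φ a)

  Triangle : (V → V → Set) → V → V → V → Set
  Triangle E x y z = E x y × E y z × E x z

  -- X = {a,u,v}, Y = {b,u,v} triangles, X ∩ Y = {u,v} between a and b.
  -- (a ≠ b, hence |X ∩ Y| = 2, is forced by the betweenness condition.)
  Is3CE : (V → V → Set) → Ordering V → Set
  Is3CE E φ = ∀ a b u v → u ≢ v → Triangle E a u v → Triangle E b u v →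
              Between φ a u b → Between φ a v b → E a b

-- Vertices:  old u (u ∈ V(G));  the four cliques A,B,C,D, each indexed
-- by Fin 4 with index zero = a (resp. b,c,d) and index suc i = a_{i+1};
-- f e k  for k : Fin 6 is f^e_{k+1};  t e i for i : Fin 3 is t^e_{i+1}.

data V' (G : SimpleGraph) : Set where
  old : Vtx G → V' G
  va vb vc vd : Fin 4 → V' G
  vf : Edge G → Fin 6 → V' G
  vt : Edge G → Fin 3 → V' G

-- index of f^e_{2i-1}, f^e_{2i} (0-based: 2i, 2i+1) for i : Fin 3 (0-based)
fIdx₁ fIdx₂ : Fin 3 → Fin 6
fIdx₁ zero = zero
fIdx₁ (suc zero) = suc (suc zero)
fIdx₁ (suc (suc zero)) = suc (suc (suc (suc zero)))
fIdx₂ zero = suc zero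
fIdx₂ (suc zero) = suc (suc (suc zero))
fIdx₂ (suc (suc zero)) = suc (suc (suc (suc (suc zero))))

-- Generating (unordered) edges of G'; the adjacency of G' is the
-- symmetric closure restricted to distinct vertices.
data Gen (G : SimpleGraph) : V' G → V' G → Set where
  g-old : ∀ u v → Adj G u v → Gen G (old u) (old v)
  g-A : ∀ i j → Gen G (va i) (va j)
  g-B : ∀ i j → Gen G (vb i) (vb j)
  g-C : ∀ i j → Gen G (vc i) (vc j)
  g-D : ∀ i j → Gen G (vd i) (vd j)
  g-tf₁ : ∀ e i → Gen G (vt e i) (vf e (fIdx₁ i))
  g-tf₂ : ∀ e i → Gen G (vt e i) (vf e (fIdx₂ i))
  g-ff  : ∀ e i → Gen G (vf e (fIdx₁ i)) (vf e (fIdx₂ i))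
  g-AB : ∀ (i j : Fin 3) → Gen G (va (suc i)) (vb (suc j))
  g-BC : ∀ (i j : Fin 3) → Gen G (vb (suc i)) (vc (suc j))
  g-CD : ∀ (i j : Fin 3) → Gen G (vc (suc i)) (vd (suc j))
  g-DA : ∀ (i j : Fin 3) → Gen G (vd (suc i)) (va (suc j))
  g-A-old : ∀ (i : Fin 3) u → Gen G (va (suc i)) (old u)
  g-B-old : ∀ (i : Fin 3) u → Gen G (vb (suc i)) (old u)
  g-C-old : ∀ (i : Fin 3) u → Gen G (vc (suc i)) (old u)
  g-D-old : ∀ (i : Fin 3) u → Gen G (vd (suc i)) (old u)
  g-C-F : ∀ (i : Fin 3) e k → Gen G (vc (suc i)) (vf e k)
  g-D-F : ∀ (i : Fin 3) e k → Gen G (vd (suc i)) (vf e k)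
  g-F-end₁ : ∀ e k → Gen G (vf e k) (old (end₁ {G} e))
  g-F-end₂ : ∀ e k → Gen G (vf e k) (old (end₂ {G} e))
  g-TT : ∀ e e' (i j : Fin 2) → Gen G (vt e (suc i)) (vt e' (suc j))
  g-T1 : ∀ e e' (j : Fin 2) → Gen G (vt e zero) (vt e' (suc j))

Adj' : (G : SimpleGraph) → V' G → V' G → Set
Adj' G x y = x ≢ y × (Gen G x y ⊎ Gen G y x)

-- Send every vertex of G' to its shape: an old vertex to its colour, a clique vertex to
-- itself, and a gadget vertex f^e_k or t^e_i to its index together with the colour that
-- the ends of e avoid.  Edges of G' become edges of a "may" graph on the 67 shapes, and
-- the "must" edges among shapes lift back to edges of G'; adjacent old vertices have
-- different shapes because the colouring is proper.  Order G' by a fixed ranking of the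
-- shapes, breaking ties arbitrarily.  Two triangles violating the 3-C-E condition give
-- shapes x, u, v, y with u, v weakly between x and y, and a finite computation shows that
-- then x y is a must edge, or x, y are old vertices over a common f^e_k (so they are the
-- two ends of e), or some f^e_k sees two distinct t-vertices, which is impossible.

module Submission where

open import Defs
open import Axiom.UniquenessOfIdentityProofs using (module Decidable⇒UIP)
import Data.Bool
open import Data.Bool using (Bool; true; false; T; not; _∧_; _∨_)
open import Data.Bool.ListAction using (all)
open import Data.Bool.Properties using (T-∧; T-∨; T-≡)
open import Data.Fin using (Fin; zero; suc; toℕ; _≟_; quotient; remainder)
open import Data.Fin.Patterns using (0F; 1F; 2F; 3F)
open import Data.Fin.Properties using (+↔⊎; *↔×; toℕ<n; toℕ-injective)
open import Data.List using (List; []; _∷_)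
open import Data.List.Relation.Unary.All using (All; []; _∷_)
open import Data.List.Relation.Unary.All.Properties using (all⁺)
open import Data.Nat using (ℕ; zero; suc; _+_; _*_; _<_; _≤_; _≤ᵇ_; NonZero)
open import Data.Nat.DivMod
  using (_%_; _/_; [m+kn]%n≡m%n; m<n⇒m%n≡m; +-distrib-/; m<n⇒m/n≡0; m*n/n≡m; m*n%n≡0; /-monoˡ-≤)
open import Data.Nat.Properties using (<-irrelevant; +-identityʳ; <⇒≤; <-asym; ≤⇒≤ᵇ)
open import Data.Product using (_×_; _,_; proj₁; proj₂; ∃-syntax; ∃₂)
open import Data.Product.Function.NonDependent.Propositional using (_×-↣_)
open import Data.Sum as Sum using (_⊎_; inj₁; inj₂)
open import Data.Sum.Function.Propositional using (_⊎-↣_)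
open import Function using (_∘_; id)
open import Function.Bundles using (Equivalence; Injection; _↣_; mk↣)
open import Function.Construct.Composition using (_↣-∘_)
open import Function.Construct.Identity using (↣-id)
open import Function.Definitions using (Injective)
open import Function.Properties.Inverse using (↔⇒↣; ↔-sym)
open import Relation.Binary.PropositionalEquality
  using (_≡_; _≢_; refl; sym; trans; cong; cong₂; subst; subst₂; module ≡-Reasoning)
open import Relation.Nullary.Decidable using (⌊_⌋; fromWitnessFalse)
open import Relation.Nullary.Negation using (contradiction)

open Equivalence using (to; from)

module _ {n : ℕ} .{{_ : NonZero n}} {i : ℕ} (q : ℕ) (i<n : i < n) where

  [i+q*n]%n≡i : (i + q * n) % n ≡ i
  [i+q*n]%n≡i = trans ([m+kn]%n≡m%n i q n) (m<n⇒m%n≡m i<n)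

  [i+q*n]/n≡q : (i + q * n) / n ≡ q
  [i+q*n]/n≡q = begin
    (i + q * n) / n    ≡⟨ +-distrib-/ i (q * n) remainders<n ⟩
    i / n + q * n / n  ≡⟨ cong₂ _+_ (m<n⇒m/n≡0 i<n) (m*n/n≡m q n) ⟩
    q                  ∎
    where
    open ≡-Reasoning
    remainders<n : i % n + q * n % n < n
    remainders<n = subst (_< n) (sym (begin
      i % n + q * n % n ≡⟨ cong₂ _+_ (m<n⇒m%n≡m i<n) (m*n%n≡0 q n) ⟩
      i + 0             ≡⟨ +-identityʳ i ⟩
      i                 ∎)) i<n

module _ {A B : Set} {m n : ℕ} where

  infixr 5 _⊕_
  infixr 6 _⊗_

  _⊕_ : A ↣ Fin m → B ↣ Fin n → (A ⊎ B) ↣ Fin (m + n)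
  α ⊕ β = ↔⇒↣ (↔-sym +↔⊎) ↣-∘ (α ⊎-↣ β)

  _⊗_ : A ↣ Fin m → B ↣ Fin n → (A × B) ↣ Fin (m * n)
  α ⊗ β = ↔⇒↣ (↔-sym *↔×) ↣-∘ (α ×-↣ β)

infixr 4 _⇒_
_⇒_ : Bool → Bool → Bool
true  ⇒ q = q
false ⇒ _ = true

⇒-elim : ∀ {p q} → T (p ⇒ q) → T p → T q
⇒-elim {true} h _ = h

∧-intro : ∀ {x y} → T x → T y → T (x ∧ y)
∧-intro p q = T-∧ .from (p , q)

T-∧³ : ∀ p q r → T (p ∧ q ∧ r) → T p × T q × T r
T-∧³ true true true _ = _ , _ , _

everyFin : ∀ {n} → (Fin n → Bool) → Bool
everyFin {zero}  _ = true
everyFin {suc n} p = p zero ∧ everyFin (λ i → p (suc i))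

everyFin-sound : ∀ {n} (p : Fin n → Bool) → T (everyFin p) → ∀ i → T (p i)
everyFin-sound p h zero    = proj₁ (T-∧ .to h)
everyFin-sound p h (suc i) = everyFin-sound (λ i → p (suc i)) (proj₂ (T-∧ .to h)) i

-- vtx i stands for the old vertices of colour i; f m k and t m i for the vertices
-- f^e_{k+1} and t^e_{i+1} of the edges e whose ends avoid colour m.
data Shape : Set where
  vtx     : Fin 3 → Shape
  a b c d : Fin 4 → Shape
  f       : Fin 3 → Fin 6 → Shape
  t       : Fin 3 → Fin 3 → Shape

triangle : Fin 6 → Fin 3
triangle = quotient 2

nonzero : ∀ {n} → Fin n → Bool
nonzero zero    = false
nonzero (suc _) = true

_≢ᵇ_ : ∀ {n} → Fin n → Fin n → Bool
i ≢ᵇ j = not ⌊ i ≟ j ⌋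

≢ᵇ-intro : ∀ {n} (i j : Fin n) → i ≢ j → T (i ≢ᵇ j)
≢ᵇ-intro i j = fromWitnessFalse {a? = i ≟ j}

mustGen : Shape → Shape → Bool
mustGen (a _) (a _)   = true
mustGen (a i) (b j)   = nonzero i ∧ nonzero j
mustGen (a i) (vtx _) = nonzero i
mustGen (b _) (b _)   = true
mustGen (b i) (c j)   = nonzero i ∧ nonzero j
mustGen (b i) (vtx _) = nonzero i
mustGen (c _) (c _)   = true
mustGen (c i) (d j)   = nonzero i ∧ nonzero j
mustGen (c i) (vtx _) = nonzero i
mustGen (c i) (f _ _) = nonzero i
mustGen (d _) (d _)   = true
mustGen (d i) (a j)   = nonzero i ∧ nonzero j
mustGen (d i) (vtx _) = nonzero i
mustGen (d i) (f _ _) = nonzero i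
mustGen (t _ _) (t _ j) = nonzero j
mustGen _ _           = false

mayGen : Shape → Shape → Bool
mayGen (vtx i) (vtx j)   = i ≢ᵇ j
mayGen (a i) (a j)       = i ≢ᵇ j
mayGen (b i) (b j)       = i ≢ᵇ j
mayGen (c i) (c j)       = i ≢ᵇ j
mayGen (d i) (d j)       = i ≢ᵇ j
mayGen (t m i) (f m′ k)  = ⌊ m ≟ m′ ⌋ ∧ ⌊ i ≟ triangle k ⌋
mayGen (f m k) (f m′ l)  = ⌊ m ≟ m′ ⌋ ∧ ⌊ triangle k ≟ triangle l ⌋ ∧ k ≢ᵇ l
mayGen (f m _) (vtx i)   = i ≢ᵇ m
mayGen s s′              = mustGen s s′

mustAdj mayAdj : Shape → Shape → Bool
mustAdj s s′ = mustGen s s′ ∨ mustGen s′ s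
mayAdj s s′ = mayGen s s′ ∨ mayGen s′ s

-- An edge avoiding a colour m ≢ 0 meets V₀, and its gadget sits between V₀ and V₁; the
-- gadgets of the edges between V₁ and V₂ sit between V₁ and V₂.
gadgetBlock : Fin 3 → Fin 3 → ℕ → ℕ
gadgetBlock 0F 0F p = 16 + p
gadgetBlock 0F _  p = 19 + p
gadgetBlock _  0F p = 12 + p
gadgetBlock _  _  p = 9 + p

block : Shape → ℕ
block (a 1F)   = 0
block (a 2F)   = 1
block (c 1F)   = 2
block (c 2F)   = 3
block (a 0F)   = 4
block (a 3F)   = 5
block (c 0F)   = 6
block (c 3F)   = 7
block (vtx 0F) = 8
block (vtx 1F) = 15
block (vtx 2F) = 22
block (f m k)  = gadgetBlock m (triangle k) (2 * toℕ (remainder {3} 2 k))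
block (t m i)  = gadgetBlock m i 1
block (d 3F)   = 23
block (d 0F)   = 24
block (b 3F)   = 25
block (b 0F)   = 26
block (b 1F)   = 27
block (b 2F)   = 28
block (d 1F)   = 29
block (d 2F)   = 30

-- Inside a block the order of G' is arbitrary, so only the weak block order is available.
weaklyBetween : Shape → Shape → Shape → Bool
weaklyBetween x u y =
  (block x ≤ᵇ block u) ∧ (block u ≤ᵇ block y) ∨ (block y ≤ᵇ block u) ∧ (block u ≤ᵇ block x)

isVtx isF isT : Shape → Bool
isVtx (vtx _) = true
isVtx _       = false
isF (f _ _) = true
isF _       = false
isT (t _ _) = true
isT _       = false

vtxPairOverF : Shape → Shape → Shape → Bool
vtxPairOverF x y u = isVtx x ∧ isVtx y ∧ isF u

fSeesTwoT : Shape → Shape → Shape → Bool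
fSeesTwoT x u v = isF x ∧ isT u ∧ isT v

settled : Shape → Shape → Shape → Shape → Bool
settled x y u v = mustAdj x y ∨ vtxPairOverF x y u ∨ fSeesTwoT x u v ∨ fSeesTwoT y u v

families : (Shape → Bool) → List Bool
families p =
  everyFin (λ i → p (vtx i)) ∷ everyFin (λ i → p (a i)) ∷ everyFin (λ i → p (b i)) ∷
  everyFin (λ i → p (c i)) ∷ everyFin (λ i → p (d i)) ∷
  everyFin (λ m → everyFin (λ k → p (f m k))) ∷ everyFin (λ m → everyFin (λ i → p (t m i))) ∷ []

every : (Shape → Bool) → Bool
every p = all id (families p)

every-sound : ∀ p → every p ≡ true → ∀ s → T (p s)
every-sound p h = sound (all⁺ id (families p) (T-≡ .from h))
  where
  sound : All T (families p) → ∀ s → T (p s)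
  sound (hv ∷ _) (vtx i) = everyFin-sound (λ i → p (vtx i)) hv i
  sound (_ ∷ ha ∷ _) (a i) = everyFin-sound (λ i → p (a i)) ha i
  sound (_ ∷ _ ∷ hb ∷ _) (b i) = everyFin-sound (λ i → p (b i)) hb i
  sound (_ ∷ _ ∷ _ ∷ hc ∷ _) (c i) = everyFin-sound (λ i → p (c i)) hc i
  sound (_ ∷ _ ∷ _ ∷ _ ∷ hd ∷ _) (d i) = everyFin-sound (λ i → p (d i)) hd i
  sound (_ ∷ _ ∷ _ ∷ _ ∷ _ ∷ hf ∷ _) (f m k) =
    everyFin-sound (λ k → p (f m k)) (everyFin-sound (λ m → everyFin (λ k → p (f m k))) hf m) k
  sound (_ ∷ _ ∷ _ ∷ _ ∷ _ ∷ _ ∷ ht ∷ _) (t m i) =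
    everyFin-sound (λ i → p (t m i)) (everyFin-sound (λ m → everyFin (λ i → p (t m i))) ht m) i

noViolationAt : Shape → Shape → Shape → Shape → Bool
noViolationAt u v x y =
  mayAdj y u ∧ mayAdj y v ∧ weaklyBetween x u y ∧ weaklyBetween x v y ⇒ settled x y u v

noViolationOver : Shape → Shape → Shape → Bool
noViolationOver u v x = mayAdj x u ∧ mayAdj x v ⇒ every (noViolationAt u v x)

noViolationOn : Shape → Shape → Bool
noViolationOn u v = mayAdj u v ⇒ every (noViolationOver u v)

-- Stated with _≡_ rather than T: normalising the closed term once is fast, whereas
-- T (every ...) would be weak-head reduced whenever its type is compared.
shapeCheck : every (λ u → every (noViolationOn u)) ≡ true
shapeCheck = refl

configuration-settled : ∀ x y u v → T (mayAdj u v) → T (mayAdj x u) → T (mayAdj x v) →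
                        T (mayAdj y u) → T (mayAdj y v) →
                        T (weaklyBetween x u y) → T (weaklyBetween x v y) → T (settled x y u v)
configuration-settled x y u v uv xu xv yu yv xuy xvy =
  ⇒-elim (every-sound (noViolationAt u v x) (T-≡ .to overX) y)
         (∧-intro yu (∧-intro yv (∧-intro xuy xvy)))
  where
  onUV : T (noViolationOn u v)
  onUV = every-sound (noViolationOn u)
           (T-≡ .to (every-sound (λ u → every (noViolationOn u)) shapeCheck u)) v
  overX : T (every (noViolationAt u v x))
  overX = ⇒-elim (every-sound (noViolationOver u v) (T-≡ .to (⇒-elim onUV uv)) x) (∧-intro xu xv)

end-adjacent : ∀ {G} (e : Edge G) → Adj G (end₁ {G} e) (end₂ {G} e)
end-adjacent (_ , _ , _ , uv) = uv

third : Fin 3 → Fin 3 → Fin 3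
third 0F 1F = 2F
third 1F 0F = 2F
third 0F 2F = 1F
third 2F 0F = 1F
third _  _  = 0F

third-fresh : ∀ i j → i ≢ j → i ≢ third i j × j ≢ third i j
third-fresh 0F 0F i≢j = contradiction refl i≢j
third-fresh 1F 1F i≢j = contradiction refl i≢j
third-fresh 2F 2F i≢j = contradiction refl i≢j
third-fresh 0F 1F _ = (λ ()) , (λ ())
third-fresh 0F 2F _ = (λ ()) , (λ ())
third-fresh 1F 0F _ = (λ ()) , (λ ())
third-fresh 1F 2F _ = (λ ()) , (λ ())
third-fresh 2F 0F _ = (λ ()) , (λ ())
third-fresh 2F 1F _ = (λ ()) , (λ ())

triangle-fIdx₁ : ∀ i → triangle (fIdx₁ i) ≡ i
triangle-fIdx₁ 0F = refl
triangle-fIdx₁ 1F = refl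
triangle-fIdx₁ 2F = refl

triangle-fIdx₂ : ∀ i → triangle (fIdx₂ i) ≡ i
triangle-fIdx₂ 0F = refl
triangle-fIdx₂ 1F = refl
triangle-fIdx₂ 2F = refl

gadget-triangle-mayGen : ∀ m i → T (mayGen (t m i) (f m (fIdx₁ i)))
                                × T (mayGen (t m i) (f m (fIdx₂ i)))
                                × T (mayGen (f m (fIdx₁ i)) (f m (fIdx₂ i)))
gadget-triangle-mayGen 0F 0F = _ , _ , _
gadget-triangle-mayGen 0F 1F = _ , _ , _
gadget-triangle-mayGen 0F 2F = _ , _ , _
gadget-triangle-mayGen 1F 0F = _ , _ , _
gadget-triangle-mayGen 1F 1F = _ , _ , _
gadget-triangle-mayGen 1F 2F = _ , _ , _
gadget-triangle-mayGen 2F 0F = _ , _ , _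
gadget-triangle-mayGen 2F 1F = _ , _ , _
gadget-triangle-mayGen 2F 2F = _ , _ , _

module Encoding (G : SimpleGraph) where

  ends : Edge G → Vtx G × Vtx G
  ends e = end₁ {G} e , end₂ {G} e

  ends-injective : Injective _≡_ _≡_ ends
  ends-injective {u , v , u<v , uv} {_ , _ , u<v′ , uv′} refl =
    cong₂ (λ p q → u , v , p , q) (<-irrelevant u<v u<v′) (≡-irrelevant uv uv′)
    where open Decidable⇒UIP Data.Bool._≟_ using (≡-irrelevant)

  Parts : Set
  Parts = Fin 4 ⊎ Fin 4 ⊎ Fin 4 ⊎ Fin 4 ⊎ Vtx G ⊎ Edge G × Fin 6 ⊎ Edge G × Fin 3

  toParts : V' G → Parts
  toParts (va i)   = inj₁ i
  toParts (vb i)   = inj₂ (inj₁ i)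
  toParts (vc i)   = inj₂ (inj₂ (inj₁ i))
  toParts (vd i)   = inj₂ (inj₂ (inj₂ (inj₁ i)))
  toParts (old u)  = inj₂ (inj₂ (inj₂ (inj₂ (inj₁ u))))
  toParts (vf e k) = inj₂ (inj₂ (inj₂ (inj₂ (inj₂ (inj₁ (e , k))))))
  toParts (vt e i) = inj₂ (inj₂ (inj₂ (inj₂ (inj₂ (inj₂ (e , i))))))

  fromParts : Parts → V' G
  fromParts (inj₁ i) = va i
  fromParts (inj₂ (inj₁ i)) = vb i
  fromParts (inj₂ (inj₂ (inj₁ i))) = vc i
  fromParts (inj₂ (inj₂ (inj₂ (inj₁ i)))) = vd i
  fromParts (inj₂ (inj₂ (inj₂ (inj₂ (inj₁ u))))) = old u
  fromParts (inj₂ (inj₂ (inj₂ (inj₂ (inj₂ (inj₁ (e , k))))))) = vf e k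
  fromParts (inj₂ (inj₂ (inj₂ (inj₂ (inj₂ (inj₂ (e , i))))))) = vt e i

  fromParts∘toParts : ∀ x → fromParts (toParts x) ≡ x
  fromParts∘toParts (va _)   = refl
  fromParts∘toParts (vb _)   = refl
  fromParts∘toParts (vc _)   = refl
  fromParts∘toParts (vd _)   = refl
  fromParts∘toParts (old _)  = refl
  fromParts∘toParts (vf _ _) = refl
  fromParts∘toParts (vt _ _) = refl

  toParts-injective : Injective _≡_ _≡_ toParts
  toParts-injective {x} {y} eq = begin
    x                     ≡⟨ fromParts∘toParts x ⟨
    fromParts (toParts x) ≡⟨ cong fromParts eq ⟩
    fromParts (toParts y) ≡⟨ fromParts∘toParts y ⟩
    y                     ∎
    where open ≡-Reasoning

  size : ℕ
  size = 4 + (4 + (4 + (4 + (n G + (n G * n G * 6 + n G * n G * 3)))))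

  encoding : V' G ↣ Fin size
  encoding = (↣-id _ ⊕ ↣-id _ ⊕ ↣-id _ ⊕ ↣-id _ ⊕ ↣-id _ ⊕ edge↣ ⊗ ↣-id _ ⊕ edge↣ ⊗ ↣-id _)
             ↣-∘ mk↣ toParts-injective
    where
    edge↣ : Edge G ↣ Fin (n G * n G)
    edge↣ = (↣-id _ ⊗ ↣-id _) ↣-∘ mk↣ ends-injective

module Colouring (G : SimpleGraph) (colour : Vtx G → Fin 3)
                 (proper : ∀ u v → Adj G u v → colour u ≢ colour v) where

  open Encoding G using (size; encoding)

  avoidedColour : Edge G → Fin 3
  avoidedColour e = third (colour (end₁ {G} e)) (colour (end₂ {G} e))

  avoidedColour-fresh : ∀ e → colour (end₁ {G} e) ≢ avoidedColour e
                            × colour (end₂ {G} e) ≢ avoidedColour e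
  avoidedColour-fresh e = third-fresh _ _ (proper _ _ (end-adjacent {G} e))

  shape : V' G → Shape
  shape (old u)  = vtx (colour u)
  shape (va i)   = a i
  shape (vb i)   = b i
  shape (vc i)   = c i
  shape (vd i)   = d i
  shape (vf e k) = f (avoidedColour e) k
  shape (vt e i) = t (avoidedColour e) i

  code : V' G → Fin size
  code = Injection.to encoding

  rank : V' G → ℕ
  rank x = toℕ (code x) + block (shape x) * size

  rank-injective : Injective _≡_ _≡_ rank
  rank-injective {x} {y} rx≡ry = Injection.injective encoding (toℕ-injective (begin
    toℕ (code x)  ≡⟨ [i+q*n]%n≡i (block (shape x)) (toℕ<n (code x)) ⟨
    rank x % size ≡⟨ cong (_% size) rx≡ry ⟩
    rank y % size ≡⟨ [i+q*n]%n≡i (block (shape y)) (toℕ<n (code y)) ⟩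
    toℕ (code y)  ∎))
    where open ≡-Reasoning

  ordering : Ordering (V' G)
  ordering = rank , rank-injective

  block-mono : ∀ x y → rank x < rank y → block (shape x) ≤ block (shape y)
  block-mono x y rx<ry = subst₂ _≤_
    ([i+q*n]/n≡q (block (shape x)) (toℕ<n (code x)))
    ([i+q*n]/n≡q (block (shape y)) (toℕ<n (code y)))
    (/-monoˡ-≤ size (<⇒≤ rx<ry))

  between⇒weaklyBetween : ∀ x u y → Between ordering x u y →
                          T (weaklyBetween (shape x) (shape u) (shape y))
  between⇒weaklyBetween x u y (inj₁ (x<u , u<y)) =
    T-∨ .from (inj₁ (∧-intro (≤⇒≤ᵇ (block-mono x u x<u)) (≤⇒≤ᵇ (block-mono u y u<y))))
  between⇒weaklyBetween x u y (inj₂ (y<u , u<x)) =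
    T-∨ .from (inj₂ (∧-intro (≤⇒≤ᵇ (block-mono y u y<u)) (≤⇒≤ᵇ (block-mono u x u<x))))

  between⇒distinct : ∀ x u y → Between ordering x u y → x ≢ y
  between⇒distinct _ _ _ (inj₁ (x<u , u<y)) refl = <-asym x<u u<y
  between⇒distinct _ _ _ (inj₂ (y<u , u<x)) refl = <-asym y<u u<x

  gen⇒mayGen : ∀ {x y} → Gen G x y → x ≢ y → T (mayGen (shape x) (shape y))
  gen⇒mayGen (g-old u v uv)  _   = ≢ᵇ-intro _ _ (proper u v uv)
  gen⇒mayGen (g-A i j)       x≢y = ≢ᵇ-intro i j (x≢y ∘ cong va)
  gen⇒mayGen (g-B i j)       x≢y = ≢ᵇ-intro i j (x≢y ∘ cong vb)
  gen⇒mayGen (g-C i j)       x≢y = ≢ᵇ-intro i j (x≢y ∘ cong vc)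
  gen⇒mayGen (g-D i j)       x≢y = ≢ᵇ-intro i j (x≢y ∘ cong vd)
  gen⇒mayGen (g-tf₁ e i)     _   = proj₁ (gadget-triangle-mayGen (avoidedColour e) i)
  gen⇒mayGen (g-tf₂ e i)     _   = proj₁ (proj₂ (gadget-triangle-mayGen (avoidedColour e) i))
  gen⇒mayGen (g-ff e i)      _   = proj₂ (proj₂ (gadget-triangle-mayGen (avoidedColour e) i))
  gen⇒mayGen (g-AB _ _)      _   = _
  gen⇒mayGen (g-BC _ _)      _   = _
  gen⇒mayGen (g-CD _ _)      _   = _
  gen⇒mayGen (g-DA _ _)      _   = _
  gen⇒mayGen (g-A-old _ _)   _   = _
  gen⇒mayGen (g-B-old _ _)   _   = _
  gen⇒mayGen (g-C-old _ _)   _   = _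
  gen⇒mayGen (g-D-old _ _)   _   = _
  gen⇒mayGen (g-C-F _ _ _)   _   = _
  gen⇒mayGen (g-D-F _ _ _)   _   = _
  gen⇒mayGen (g-F-end₁ e _)  _   = ≢ᵇ-intro _ _ (proj₁ (avoidedColour-fresh e))
  gen⇒mayGen (g-F-end₂ e _)  _   = ≢ᵇ-intro _ _ (proj₂ (avoidedColour-fresh e))
  gen⇒mayGen (g-TT _ _ _ _)  _   = _
  gen⇒mayGen (g-T1 _ _ _)    _   = _

  adj'⇒mayAdj : ∀ {x y} → Adj' G x y → T (mayAdj (shape x) (shape y))
  adj'⇒mayAdj (x≢y , inj₁ xy) = T-∨ .from (inj₁ (gen⇒mayGen xy x≢y))
  adj'⇒mayAdj (x≢y , inj₂ yx) = T-∨ .from (inj₂ (gen⇒mayGen yx (x≢y ∘ sym)))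

  mustGen⇒gen : ∀ x y → T (mustGen (shape x) (shape y)) → Gen G x y
  mustGen⇒gen (old _)      _            ()
  mustGen⇒gen (vf _ _)     _            ()
  mustGen⇒gen (va i)       (va j)       _ = g-A i j
  mustGen⇒gen (va (suc i)) (vb (suc j)) _ = g-AB i j
  mustGen⇒gen (va (suc i)) (old u)      _ = g-A-old i u
  mustGen⇒gen (va zero)    (vb _)       ()
  mustGen⇒gen (va (suc _)) (vb zero)    ()
  mustGen⇒gen (va zero)    (old _)      ()
  mustGen⇒gen (va _)       (vc _)       ()
  mustGen⇒gen (va _)       (vd _)       ()
  mustGen⇒gen (va _)       (vf _ _)     ()
  mustGen⇒gen (va _)       (vt _ _)     ()
  mustGen⇒gen (vb i)       (vb j)       _ = g-B i j
  mustGen⇒gen (vb (suc i)) (vc (suc j)) _ = g-BC i j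
  mustGen⇒gen (vb (suc i)) (old u)      _ = g-B-old i u
  mustGen⇒gen (vb zero)    (vc _)       ()
  mustGen⇒gen (vb (suc _)) (vc zero)    ()
  mustGen⇒gen (vb zero)    (old _)      ()
  mustGen⇒gen (vb _)       (va _)       ()
  mustGen⇒gen (vb _)       (vd _)       ()
  mustGen⇒gen (vb _)       (vf _ _)     ()
  mustGen⇒gen (vb _)       (vt _ _)     ()
  mustGen⇒gen (vc i)       (vc j)       _ = g-C i j
  mustGen⇒gen (vc (suc i)) (vd (suc j)) _ = g-CD i j
  mustGen⇒gen (vc (suc i)) (old u)      _ = g-C-old i u
  mustGen⇒gen (vc (suc i)) (vf e k)     _ = g-C-F i e k
  mustGen⇒gen (vc zero)    (vd _)       ()
  mustGen⇒gen (vc (suc _)) (vd zero)    ()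
  mustGen⇒gen (vc zero)    (old _)      ()
  mustGen⇒gen (vc zero)    (vf _ _)     ()
  mustGen⇒gen (vc _)       (va _)       ()
  mustGen⇒gen (vc _)       (vb _)       ()
  mustGen⇒gen (vc _)       (vt _ _)     ()
  mustGen⇒gen (vd i)       (vd j)       _ = g-D i j
  mustGen⇒gen (vd (suc i)) (va (suc j)) _ = g-DA i j
  mustGen⇒gen (vd (suc i)) (old u)      _ = g-D-old i u
  mustGen⇒gen (vd (suc i)) (vf e k)     _ = g-D-F i e k
  mustGen⇒gen (vd zero)    (va _)       ()
  mustGen⇒gen (vd (suc _)) (va zero)    ()
  mustGen⇒gen (vd zero)    (old _)      ()
  mustGen⇒gen (vd zero)    (vf _ _)     ()
  mustGen⇒gen (vd _)       (vb _)       ()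
  mustGen⇒gen (vd _)       (vc _)       ()
  mustGen⇒gen (vd _)       (vt _ _)     ()
  mustGen⇒gen (vt e zero)    (vt e′ (suc j)) _ = g-T1 e e′ j
  mustGen⇒gen (vt e (suc i)) (vt e′ (suc j)) _ = g-TT e e′ i j
  mustGen⇒gen (vt _ _)     (vt _ zero)  ()
  mustGen⇒gen (vt _ _)     (old _)      ()
  mustGen⇒gen (vt _ _)     (va _)       ()
  mustGen⇒gen (vt _ _)     (vb _)       ()
  mustGen⇒gen (vt _ _)     (vc _)       ()
  mustGen⇒gen (vt _ _)     (vd _)       ()
  mustGen⇒gen (vt _ _)     (vf _ _)     ()

  mustAdj⇒adj' : ∀ x y → T (mustAdj (shape x) (shape y)) → x ≢ y → Adj' G x y
  mustAdj⇒adj' x y h x≢y = x≢y , Sum.map (mustGen⇒gen x y) (mustGen⇒gen y x) (T-∨ .to h)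

  isVtx⇒old : ∀ x → T (isVtx (shape x)) → ∃[ w ] x ≡ old w
  isVtx⇒old (old w)  _ = w , refl
  isVtx⇒old (va _)   ()
  isVtx⇒old (vb _)   ()
  isVtx⇒old (vc _)   ()
  isVtx⇒old (vd _)   ()
  isVtx⇒old (vf _ _) ()
  isVtx⇒old (vt _ _) ()

  isF⇒vf : ∀ x → T (isF (shape x)) → ∃₂ λ e k → x ≡ vf e k
  isF⇒vf (vf e k) _ = e , k , refl
  isF⇒vf (old _)  ()
  isF⇒vf (va _)   ()
  isF⇒vf (vb _)   ()
  isF⇒vf (vc _)   ()
  isF⇒vf (vd _)   ()
  isF⇒vf (vt _ _) ()

  isT⇒vt : ∀ x → T (isT (shape x)) → ∃₂ λ e i → x ≡ vt e i
  isT⇒vt (vt e i) _ = e , i , refl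
  isT⇒vt (old _)  ()
  isT⇒vt (va _)   ()
  isT⇒vt (vb _)   ()
  isT⇒vt (vc _)   ()
  isT⇒vt (vd _)   ()
  isT⇒vt (vf _ _) ()

  f-neighbour-is-end : ∀ {w e k} → Adj' G (old w) (vf e k) → w ≡ end₁ {G} e ⊎ w ≡ end₂ {G} e
  f-neighbour-is-end (_ , inj₁ ())
  f-neighbour-is-end (_ , inj₂ (g-F-end₁ _ _)) = inj₁ refl
  f-neighbour-is-end (_ , inj₂ (g-F-end₂ _ _)) = inj₂ refl

  f-neighbour-is-t : ∀ {e k e′ i} → Adj' G (vf e k) (vt e′ i) → vt {G} e′ i ≡ vt e (triangle k)
  f-neighbour-is-t (_ , inj₁ ())
  f-neighbour-is-t (_ , inj₂ (g-tf₁ e i)) = cong (vt e) (sym (triangle-fIdx₁ i))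
  f-neighbour-is-t (_ , inj₂ (g-tf₂ e i)) = cong (vt e) (sym (triangle-fIdx₂ i))

  common-f-neighbours-adjacent : ∀ {x y u} → T (vtxPairOverF (shape x) (shape y) (shape u)) →
                                 Adj' G x u → Adj' G y u → x ≢ y → Adj' G x y
  common-f-neighbours-adjacent {x} {y} {u} h xu yu x≢y
    with T-∧³ (isVtx (shape x)) (isVtx (shape y)) (isF (shape u)) h
  ... | vx , vy , fu with isVtx⇒old x vx | isVtx⇒old y vy | isF⇒vf u fu
  ... | _ , refl | _ , refl | e , _ , refl with f-neighbour-is-end xu | f-neighbour-is-end yu
  ... | inj₁ refl | inj₁ refl = contradiction refl x≢y
  ... | inj₁ refl | inj₂ refl = x≢y , inj₁ (g-old _ _ (end-adjacent {G} e))
  ... | inj₂ refl | inj₁ refl = x≢y , inj₂ (g-old _ _ (end-adjacent {G} e))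
  ... | inj₂ refl | inj₂ refl = contradiction refl x≢y

  f-t-neighbours-equal : ∀ {x u v} → T (fSeesTwoT (shape x) (shape u) (shape v)) →
                         Adj' G x u → Adj' G x v → u ≡ v
  f-t-neighbours-equal {x} {u} {v} h xu xv
    with T-∧³ (isF (shape x)) (isT (shape u)) (isT (shape v)) h
  ... | fx , tu , tv with isF⇒vf x fx | isT⇒vt u tu | isT⇒vt v tv
  ... | _ , _ , refl | _ , _ , refl | _ , _ , refl =
    trans (f-neighbour-is-t xu) (sym (f-neighbour-is-t xv))

  settled-adjacent : ∀ {x y u v} → u ≢ v → x ≢ y →
                     Adj' G x u → Adj' G x v → Adj' G y u → Adj' G y v →
                     T (settled (shape x) (shape y) (shape u) (shape v)) → Adj' G x y
  settled-adjacent {x} {y} u≢v x≢y xu xv yu yv h with T-∨ .to h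
  ... | inj₁ must = mustAdj⇒adj' x y must x≢y
  ... | inj₂ h′ with T-∨ .to h′
  ... | inj₁ over-f = common-f-neighbours-adjacent over-f xu yu x≢y
  ... | inj₂ h″ with T-∨ .to h″
  ... | inj₁ x-sees-two-t = contradiction (f-t-neighbours-equal x-sees-two-t xu xv) u≢v
  ... | inj₂ y-sees-two-t = contradiction (f-t-neighbours-equal y-sees-two-t yu yv) u≢v

  is3CE : Is3CE (Adj' G) ordering
  is3CE x y u v u≢v (xu , uv , xv) (yu , _ , yv) xuy xvy =
    settled-adjacent u≢v (between⇒distinct x u y xuy) xu xv yu yv
      (configuration-settled (shape x) (shape y) (shape u) (shape v)
        (adj'⇒mayAdj uv) (adj'⇒mayAdj xu) (adj'⇒mayAdj xv) (adj'⇒mayAdj yu) (adj'⇒mayAdj yv)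
        (between⇒weaklyBetween x u y xuy) (between⇒weaklyBetween x v y xvy))

mainTheorem14 : (G : SimpleGraph) → ThreeColourable G →
                  ∃[ φ ] Is3CE {V' G} (Adj' G) φ
mainTheorem14 G (colour , proper) = ordering , is3CE
  where open Colouring G colour proper
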